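{- Consider the algorithm RecursiveCancel on the line metric, defined below. If during its execution the client matched to a server $s$ is changed from $c_1$ to $c_2$, then $\ell(c_2)\ge\ell(c_1)$.
   Context: Line metric: each point $x$ has location $\ell(x)\in\mathbb{R}$, $d(x,y)=|\ell(x)-\ell(y)|$; all clients and servers are at distinct locations. A multiset $S$ of $k$ servers is given; clients $c_1,\dots,c_k$ arrive online, $C_t=(c_1,\dots,c_t)$. Cost of a matching = sum of client–server distances. Fix a sequence of minimum-cost matchings $\mathcal{M}^*_t$ of $C_t$ into $S$ whose used server sets $S^*_t$ are nested, $S^*_1\subseteq\cdots\subseteq S^*_k$; the Permutation server for $c_t$ is the unique server $s_t\in S^*_t\setminus S^*_{t-1}$. A matched pair $(c,s)$ is a forward arc if $\ell(c)\le\ell(s)$ and a backward arc otherwise; two arcs overlap if the closed intervals between their endpoints intersect. RecursiveCancel: $\mathcal{M}_0=\emptyset$. When $c_t$ arrives, let $a=(c_t,s_t)$. If $a$ is a forward arc, set $\mathcal{M}_t=\mathcal{M}_{t-1}\cup\{a\}$. Otherwise, while the current matching contains a forward arc overlapping the current backward arc $a=(c,s)$: let $(c',s')$ be the overlapping forward arc with the rightmost server $s'$, replace $(c',s')$ by $(c,s')$, and set $a:=(c',s)$; when no forward arc overlaps $a$, add $a$ to obtain $\mathcal{M}_t$.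
   Formalization: The locations $\ell(x)$ of all clients and servers are rational numbers rather than real numbers. -}

module Defs where

open import Data.Nat using (ℕ; zero; suc)
import Data.Nat as ℕ
open import Data.Fin using (Fin; toℕ)
open import Data.Rational using (ℚ; 0ℚ; _+_; _-_; ∣_∣; _≤_; _⊓_; _⊔_)
open import Data.List using (List; []; _∷_; _++_; foldr; map; filter; allFin)
open import Data.List.Membership.Propositional using (_∈_)
open import Data.Maybe using (Maybe; just; nothing)
open import Data.Product using (_×_; _,_; ∃; Σ)
open import Relation.Nullary using (¬_)
open import Relation.Binary.PropositionalEquality using (_≡_)
open import Function.Definitions using (Injective)

-- Line metric: points have rational locations, d(x,y) = |ℓ(x) - ℓ(y)|.
dist : ℚ → ℚ → ℚ
dist x y = ∣ x - y ∣

sumℚ : List ℚ → ℚ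
sumℚ = foldr _+_ 0ℚ

-- Clients c_1..c_k are indexed by Fin k (c_{j+1} has
-- index j), servers by Fin k.  A matching of the prefix C_t into S is a
-- map m : Fin k → Fin k whose values on the clients with index < t are
-- the matched servers (values on later clients are irrelevant), and
-- which is injective on that prefix.

InPrefix : ∀ {k} → ℕ → Fin k → Set
InPrefix t i = toℕ i ℕ.< t

IsMatchingOfPrefix : ∀ {k} → ℕ → (Fin k → Fin k) → Set
IsMatchingOfPrefix t m = ∀ i j → InPrefix t i → InPrefix t j → m i ≡ m j → i ≡ j

prefixCost : ∀ {k} → (lc ls : Fin k → ℚ) → ℕ → (Fin k → Fin k) → ℚ
prefixCost {k} lc ls t m =
  sumℚ (map (λ i → dist (lc i) (ls (m i))) (filter (λ i → toℕ i ℕ.<? t) (allFin k)))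

IsMinCostMatching : ∀ {k} → (lc ls : Fin k → ℚ) → ℕ → (Fin k → Fin k) → Set
IsMinCostMatching lc ls t m =
  IsMatchingOfPrefix t m ×
  (∀ m′ → IsMatchingOfPrefix t m′ → prefixCost lc ls t m ≤ prefixCost lc ls t m′)

UsedBy : ∀ {k} → ℕ → (Fin k → Fin k) → Fin k → Set
UsedBy t m s = ∃ λ i → InPrefix t i × m i ≡ s

-- The algorithm RecursiveCancel, as a labelled transition system.
-- Parameters: client locations lc, server locations ls, and the
-- Permutation server σ i of the client with index i.

module RecursiveCancel {k : ℕ} (lc ls : Fin k → ℚ) (σ : Fin k → Fin k) where

  -- an arc is a matched pair (client , server)
  Arc : Set
  Arc = Fin k × Fin k

  Matching : Set
  Matching = List Arc

  Forward : Arc → Set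
  Forward (c , s) = lc c ≤ ls s

  lo hi : Arc → ℚ
  lo (c , s) = lc c ⊓ ls s
  hi (c , s) = lc c ⊔ ls s

  Overlap : Arc → Arc → Set
  Overlap a b = (lo a ≤ hi b) × (lo b ≤ hi a)

  -- idle t M   : clients c_1..c_t processed, current matching M = 𝓜_t
  -- busy t M a : processing client with index t (i.e. c_{t+1}),
  --              current matching M, current arc a
  data Config : Set where
    idle : ℕ → Matching → Config
    busy : ℕ → Matching → Arc → Config

  -- label: just (s , c₁ , c₂) means the client matched to server s
  -- is changed from c₁ to c₂
  Label : Set
  Label = Maybe (Fin k × Fin k × Fin k)

  data Step : Config → Label → Config → Set where
    arriveForward : ∀ {M} (i : Fin k) → Forward (i , σ i) →
      Step (idle (toℕ i) M) nothing (idle (suc (toℕ i)) ((i , σ i) ∷ M))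
    arriveBackward : ∀ {M} (i : Fin k) → ¬ Forward (i , σ i) →
      Step (idle (toℕ i) M) nothing (busy (toℕ i) M (i , σ i))
    cancel : ∀ {t} M₁ M₂ c s c′ s′ →
      Forward (c′ , s′) → Overlap (c′ , s′) (c , s) →
      (∀ a → a ∈ (M₁ ++ (c′ , s′) ∷ M₂) → Forward a → Overlap a (c , s) →
         ls (Data.Product.proj₂ a) ≤ ls s′) →
      Step (busy t (M₁ ++ (c′ , s′) ∷ M₂) (c , s))
           (just (s′ , c′ , c))
           (busy t (M₁ ++ (c , s′) ∷ M₂) (c′ , s))
    finish : ∀ {t M} a →
      (∀ b → b ∈ M → Forward b → ¬ Overlap b a) →
      Step (busy t M a) nothing (idle (suc t) (a ∷ M))

  data Reachable : Config → Set where
    start : Reachable (idle 0 [])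
    next  : ∀ {x e y} → Reachable x → Step x e y → Reachable y

{-# OPTIONS --safe #-}
-- The current arc (c , s) of the cancelling loop is always backward, so the forward arc (c′ , s′)
-- it overlaps, whose client c′ hands s′ over to c, has ℓ(c′) ≤ ℓ(c).  The current arc stays
-- backward because its server s is not in S*_t while every server under a forward arc of 𝓜_t
-- is: were (c′ , s) forward, s would lie under (c′ , s′).  That invariant holds for a new forward
-- Permutation arc by optimality of M*_t and M*_{t+1} (an unused server strictly between a client
-- and its partner would be a cheaper partner), and cancelling only shortens forward arcs from the left.
module Submission where

open import Defs
open import Data.Nat using (ℕ; zero; suc; s≤s)
import Data.Nat as ℕ
import Data.Nat.Properties as ℕ
open import Data.Fin using (Fin; toℕ)
import Data.Fin as Fin
import Data.Fin.Properties as Fin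
open import Data.Rational using (ℚ; 0ℚ; _≤_; _<_; _-_; -_; ∣_∣; _⊓_; _⊔_)
open import Data.Rational.Properties
open import Data.List using ([]; _∷_; _++_; map)
open import Data.List.Membership.Propositional using (_∈_)
open import Data.List.Membership.Propositional.Properties using (∈-++⁺ˡ; ∈-++⁺ʳ; ∈-++⁻; ∈-filter⁺; ∈-allFin)
open import Data.List.Relation.Unary.Any using (here; there)
open import Data.Maybe using (just)
open import Data.Product using (_×_; _,_; ∃; ∃-syntax; proj₁; proj₂)
open import Data.Sum using (_⊎_; inj₁; inj₂)
open import Data.Empty using (⊥; ⊥-elim)
open import Data.Vec.Functional using (updateAt)
open import Data.Vec.Functional.Properties using (updateAt-updates; updateAt-minimal)
open import Function using (const; _∘′_)
open import Function.Definitions using (Injective)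
open import Relation.Binary using (tri<; tri≈; tri>)
open import Relation.Binary.PropositionalEquality using (_≡_; _≢_; refl; sym; trans; subst; subst₂)
open import Relation.Nullary using (¬_; Dec; yes; no)
open import Relation.Nullary.Decidable using (_×-dec_)

p≤q⇒p-q≤0 : ∀ {p q} → p ≤ q → p - q ≤ 0ℚ
p≤q⇒p-q≤0 {p} {q} p≤q = subst (p - q ≤_) (+-inverseʳ q) (+-monoˡ-≤ (- q) p≤q)

q≤p⇒0≤p-q : ∀ {p q} → q ≤ p → 0ℚ ≤ p - q
q≤p⇒0≤p-q {p} {q} q≤p = subst (_≤ p - q) (+-inverseʳ q) (+-monoˡ-≤ (- q) q≤p)

0≤p<q⇒∣p∣<∣q∣ : ∀ {p q} → 0ℚ ≤ p → p < q → ∣ p ∣ < ∣ q ∣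
0≤p<q⇒∣p∣<∣q∣ 0≤p p<q =
  subst₂ _<_ (sym (0≤p⇒∣p∣≡p 0≤p)) (sym (0≤p⇒∣p∣≡p (≤-trans 0≤p (<⇒≤ p<q)))) p<q

q<p≤0⇒∣p∣<∣q∣ : ∀ {p q} → q < p → p ≤ 0ℚ → ∣ p ∣ < ∣ q ∣
q<p≤0⇒∣p∣<∣q∣ {p} {q} q<p p≤0 =
  subst₂ _<_ (∣-p∣≡∣p∣ p) (∣-p∣≡∣p∣ q) (0≤p<q⇒∣p∣<∣q∣ (neg-antimono-≤ p≤0) (neg-antimono-< q<p))

overlap⇒ends≤ : ∀ {a b c d} → a ≤ b → d < c → a ⊓ b ≤ c ⊔ d × c ⊓ d ≤ a ⊔ b → a ≤ c × d ≤ b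
overlap⇒ends≤ a≤b d<c (ab≤cd , cd≤ab) =
  subst₂ _≤_ (p≤q⇒p⊓q≡p a≤b) (p≥q⇒p⊔q≡p (<⇒≤ d<c)) ab≤cd ,
  subst₂ _≤_ (p≥q⇒p⊓q≡q (<⇒≤ d<c)) (p≤q⇒p⊔q≡q a≤b) cd≤ab

StrictlyBetween : ℚ → ℚ → ℚ → Set
StrictlyBetween a b c = (a < b × b < c) ⊎ (c < b × b < a)

strictlyBetween⇒dist< : ∀ {a b c} → StrictlyBetween a b c → dist a b < dist a c
strictlyBetween⇒dist< {a} (inj₁ (a<b , b<c)) =
  q<p≤0⇒∣p∣<∣q∣ (+-monoʳ-< a (neg-antimono-< b<c)) (p≤q⇒p-q≤0 (<⇒≤ a<b))
strictlyBetween⇒dist< {a} (inj₂ (c<b , b<a)) =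
  0≤p<q⇒∣p∣<∣q∣ (q≤p⇒0≤p-q (<⇒≤ b<a)) (+-monoʳ-< a (neg-antimono-< c<b))

module _ {A : Set} (f g : A → ℚ) (f≤g : ∀ x → f x ≤ g x) where

  sumℚ-map-mono-≤ : ∀ xs → sumℚ (map f xs) ≤ sumℚ (map g xs)
  sumℚ-map-mono-≤ []       = ≤-refl
  sumℚ-map-mono-≤ (x ∷ xs) = +-mono-≤ (f≤g x) (sumℚ-map-mono-≤ xs)

  sumℚ-map-mono-< : ∀ {y} xs → y ∈ xs → f y < g y → sumℚ (map f xs) < sumℚ (map g xs)
  sumℚ-map-mono-< (x ∷ xs) (here refl) fy<gy = +-mono-<-≤ fy<gy (sumℚ-map-mono-≤ xs)
  sumℚ-map-mono-< (x ∷ xs) (there y∈xs) fy<gy = +-mono-≤-< (f≤g x) (sumℚ-map-mono-< xs y∈xs fy<gy)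

module _ {n} {P : Fin n → Set} {_⇝_ : Fin n → Fin n → Set}
         (⇝-injective : ∀ {a b c} → P a → P b → a ⇝ c → b ⇝ c → a ≡ b)
         (step : ∀ {a} → P a → ∃[ b ] P b × a ⇝ b)
         {b₀} (Pb₀ : P b₀) where

  private
    next : ∃ P → ∃ P
    next (_ , Pa) = proj₁ (step Pa) , proj₁ (proj₂ (step Pa))

    next-step : ∀ a → proj₁ a ⇝ proj₁ (next a)
    next-step (_ , Pa) = proj₂ (proj₂ (step Pa))

    walk : ℕ → ∃ P
    walk zero    = b₀ , Pb₀
    walk (suc m) = next (walk m)

  injective-successor⇒¬¬surjective : ¬ ¬ (∃[ a ] P a × a ⇝ b₀)
  injective-successor⇒¬¬surjective noPredecessor
    with Fin.pigeonhole (ℕ.n<1+n n) (λ x → proj₁ (walk (toℕ x)))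
  ... | x , y , x<y , walk-x≡walk-y = walk-injective x<y walk-x≡walk-y
    where
      walk-injective : ∀ {i j} → i ℕ.< j → proj₁ (walk i) ≢ proj₁ (walk j)
      walk-injective {zero} {suc j} _ b₀≡walk-j+1 =
        noPredecessor (proj₁ (walk j) , proj₂ (walk j) ,
                       subst (proj₁ (walk j) ⇝_) (sym b₀≡walk-j+1) (next-step (walk j)))
      walk-injective {suc i} {suc j} (s≤s i<j) eq =
        walk-injective i<j (⇝-injective (proj₂ (walk i)) (proj₂ (walk j))
                             (next-step (walk i)) (subst (proj₁ (walk j) ⇝_) (sym eq) (next-step (walk j))))

UsedBy-dec : ∀ {k} t (m : Fin k → Fin k) s → Dec (UsedBy t m s)
UsedBy-dec t m s = Fin.any? (λ i → (toℕ i ℕ.<? t) ×-dec (m i Fin.≟ s))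

module MinCostMatching {k} (lc ls : Fin k → ℚ) where

  reassign : (Fin k → Fin k) → Fin k → Fin k → Fin k → Fin k
  reassign m j u = updateAt m j (const u)

  module _ {T : ℕ} {m : Fin k → Fin k} {j u : Fin k} (j∈T : InPrefix T j) (u-unused : ¬ UsedBy T m u) where

    private
      m′ = reassign m j u

      reassign-view : ∀ i → (i ≡ j × m′ i ≡ u) ⊎ m′ i ≡ m i
      reassign-view i with i Fin.≟ j
      ... | yes refl = inj₁ (refl , updateAt-updates j m)
      ... | no i≢j   = inj₂ (updateAt-minimal i j m i≢j)

    reassign-isMatching : IsMatchingOfPrefix T m → IsMatchingOfPrefix T m′
    reassign-isMatching m-inj i₁ i₂ i₁∈T i₂∈T eq with reassign-view i₁ | reassign-view i₂
    ... | inj₁ (refl , _) | inj₁ (refl , _) = refl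
    ... | inj₁ (_ , e₁)   | inj₂ e₂ = ⊥-elim (u-unused (i₂ , i₂∈T , trans (sym e₂) (trans (sym eq) e₁)))
    ... | inj₂ e₁         | inj₁ (_ , e₂) = ⊥-elim (u-unused (i₁ , i₁∈T , trans (sym e₁) (trans eq e₂)))
    ... | inj₂ e₁         | inj₂ e₂ = m-inj i₁ i₂ i₁∈T i₂∈T (trans (sym e₁) (trans eq e₂))

    reassign-cost< : dist (lc j) (ls u) < dist (lc j) (ls (m j)) →
                     prefixCost lc ls T m′ < prefixCost lc ls T m
    reassign-cost< closer =
      sumℚ-map-mono-< cost′ cost cost′≤cost _ j-counted cost′<cost
      where
        j-counted = ∈-filter⁺ (λ i → toℕ i ℕ.<? T) (∈-allFin j) j∈T
        cost cost′ : Fin k → ℚ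
        cost  i = dist (lc i) (ls (m i))
        cost′ i = dist (lc i) (ls (m′ i))
        cost′≤cost : ∀ i → cost′ i ≤ cost i
        cost′≤cost i with reassign-view i
        ... | inj₁ (refl , e) rewrite e = <⇒≤ closer
        ... | inj₂ e rewrite e = ≤-refl
        cost′<cost : cost′ j < cost j
        cost′<cost with reassign-view j
        ... | inj₁ (_ , e) rewrite e = closer
        ... | inj₂ e = ⊥-elim (u-unused (j , j∈T , trans (sym e) (updateAt-updates j m)))

  module UnusedServer (ls-injective : Injective _≡_ _≡_ ls) (lc≢ls : ∀ i j → lc i ≢ ls j)
                      {T : ℕ} {m : Fin k → Fin k} (m-opt : IsMinCostMatching lc ls T m)
                      {j u : Fin k} (j∈T : InPrefix T j) (u-unused : ¬ UsedBy T m u) where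

    not-strictlyBetween : ¬ StrictlyBetween (lc j) (ls u) (ls (m j))
    not-strictlyBetween between =
      <-irrefl refl (≤-<-trans (proj₂ m-opt _ (reassign-isMatching j∈T u-unused (proj₁ m-opt)))
                               (reassign-cost< j∈T u-unused (strictlyBetween⇒dist< between)))

    private
      u≢partner : ls u ≢ ls (m j)
      u≢partner e = u-unused (j , j∈T , sym (ls-injective e))

    partner-left : ls u < lc j → ls u < ls (m j)
    partner-left u<j with <-cmp (ls u) (ls (m j))
    ... | tri< u<mj _ _ = u<mj
    ... | tri≈ _ u≡mj _ = ⊥-elim (u≢partner u≡mj)
    ... | tri> _ _ mj<u = ⊥-elim (not-strictlyBetween (inj₂ (mj<u , u<j)))

    partner-right : lc j < ls u → ls (m j) < ls u
    partner-right j<u with <-cmp (ls u) (ls (m j))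
    ... | tri< u<mj _ _ = ⊥-elim (not-strictlyBetween (inj₁ (j<u , u<mj)))
    ... | tri≈ _ u≡mj _ = ⊥-elim (u≢partner u≡mj)
    ... | tri> _ _ mj<u = mj<u

    client-left : ls u ≤ ls (m j) → ls u < lc j
    client-left u≤mj with <-cmp (ls u) (lc j)
    ... | tri< u<j _ _ = u<j
    ... | tri≈ _ u≡j _ = ⊥-elim (lc≢ls j u (sym u≡j))
    ... | tri> _ _ j<u = ⊥-elim (<-irrefl refl (<-≤-trans (partner-right j<u) u≤mj))

module NestedOptimum {k} (lc ls : Fin k → ℚ)
  (ls-injective : Injective _≡_ _≡_ ls) (lc≢ls : ∀ i j → lc i ≢ ls j)
  (Mstar : ℕ → Fin k → Fin k)
  (optimal : ∀ t → t ℕ.≤ k → IsMinCostMatching lc ls t (Mstar t))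
  (nested : ∀ t → t ℕ.< k → ∀ s → UsedBy t (Mstar t) s → UsedBy (suc t) (Mstar (suc t)) s)
  (σ : Fin k → Fin k)
  (σ-new : ∀ i → UsedBy (suc (toℕ i)) (Mstar (suc (toℕ i))) (σ i)
                 × ¬ UsedBy (toℕ i) (Mstar (toℕ i)) (σ i)) where

  open MinCostMatching lc ls

  unused-antitone : ∀ {t} → t ℕ.< k → ∀ {s} → ¬ UsedBy (suc t) (Mstar (suc t)) s → ¬ UsedBy t (Mstar t) s
  unused-antitone t<k unused = unused ∘′ nested _ t<k _

  -- Were u unused, σ(c_{t+1}) = M*_{t+1}(b₀), M*_t(b₀) = M*_{t+1}(b₁), M*_t(b₁) = M*_{t+1}(b₂), ...
  -- would run through the finitely many clients of C_t right of u without ever returning to b₀,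
  -- as σ(c_{t+1}) ∉ S*_t.
  module _ (i : Fin k) {u} (i≤u : lc i ≤ ls u) (u≤σi : ls u ≤ ls (σ i))
           (unused : ¬ UsedBy (suc (toℕ i)) (Mstar (suc (toℕ i))) u) where

    private
      t = toℕ i
      t<k = Fin.toℕ<n i
      M N : Fin k → Fin k
      M = Mstar (suc t)
      N = Mstar t
      M-opt = optimal (suc t) t<k
      N-opt = optimal t (ℕ.<⇒≤ t<k)

      RightOfU : Fin k → Set
      RightOfU b = toℕ b ℕ.< t × ls u < lc b

      _⇝_ : Fin k → Fin k → Set
      a ⇝ b = N a ≡ M b

      ⇝-injective : ∀ {a b c} → RightOfU a → RightOfU b → a ⇝ c → b ⇝ c → a ≡ b
      ⇝-injective a-right b-right a⇝c b⇝c =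
        proj₁ N-opt _ _ (proj₁ a-right) (proj₁ b-right) (trans a⇝c (sym b⇝c))

      partner-right⇒rightOfU : ∀ b → toℕ b ℕ.< suc t → ls u ≤ ls (M b) → RightOfU b
      partner-right⇒rightOfU b b<t+1 u≤Mb = ℕ.≤∧≢⇒< (ℕ.≤-pred b<t+1) b≢i , u<b
        where
          u<b = UnusedServer.client-left ls-injective lc≢ls M-opt b<t+1 unused u≤Mb
          b≢i : toℕ b ≢ t
          b≢i b≡i = <-irrefl refl (≤-<-trans i≤u (subst (λ x → ls u < lc x) (Fin.toℕ-injective b≡i) u<b))

      successor : ∀ {a} → RightOfU a → ∃[ b ] RightOfU b × a ⇝ b
      successor {a} (a<t , u<a) with nested t t<k (N a) (a , a<t , refl)
      ... | b , b<t+1 , Mb≡Na = b , partner-right⇒rightOfU b b<t+1 (<⇒≤ u<Mb) , sym Mb≡Na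
        where
          u<Na = UnusedServer.partner-left ls-injective lc≢ls N-opt a<t (unused-antitone t<k unused) u<a
          u<Mb = subst (λ x → ls u < ls x) (sym Mb≡Na) u<Na

      b₀ = proj₁ (proj₁ (σ-new i))
      Mb₀≡σi = proj₂ (proj₂ (proj₁ (σ-new i)))

      b₀-right : RightOfU b₀
      b₀-right = partner-right⇒rightOfU b₀ (proj₁ (proj₂ (proj₁ (σ-new i))))
                   (subst (λ x → ls u ≤ ls x) (sym Mb₀≡σi) u≤σi)

      b₀-no-predecessor : ¬ (∃[ a ] RightOfU a × a ⇝ b₀)
      b₀-no-predecessor (a , a-right , Na≡Mb₀) = proj₂ (σ-new i) (a , proj₁ a-right , trans Na≡Mb₀ Mb₀≡σi)

    unused-in-permutationSpan⇒⊥ : ⊥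
    unused-in-permutationSpan⇒⊥ =
      injective-successor⇒¬¬surjective ⇝-injective successor b₀-right b₀-no-predecessor

  permutationSpan-used : ∀ i u → lc i ≤ ls u → ls u ≤ ls (σ i) →
                         UsedBy (suc (toℕ i)) (Mstar (suc (toℕ i))) u
  permutationSpan-used i u i≤u u≤σi with UsedBy-dec (suc (toℕ i)) (Mstar (suc (toℕ i))) u
  ... | yes used  = used
  ... | no unused = ⊥-elim (unused-in-permutationSpan⇒⊥ i i≤u u≤σi unused)

  open RecursiveCancel lc ls σ

  SpanUsed : ℕ → Arc → Set
  SpanUsed t (c , s) = ∀ u → lc c ≤ ls u → ls u ≤ ls s → UsedBy t (Mstar t) u

  ForwardSpansUsed : ℕ → Matching → Set
  ForwardSpansUsed t M = ∀ a → a ∈ M → Forward a → SpanUsed t a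

  Invariant : Config → Set
  Invariant (idle t M)         = ForwardSpansUsed t M
  Invariant (busy t M (c , s)) = t ℕ.< k × ForwardSpansUsed t M × ls s < lc c × ¬ UsedBy t (Mstar t) s

  currentArc-backward : ∀ {t M c s} → Invariant (busy t M (c , s)) → ls s < lc c
  currentArc-backward (_ , _ , backward , _) = backward

  forwardSpansUsed-suc : ∀ {t M} → t ℕ.< k → ForwardSpansUsed t M → ForwardSpansUsed (suc t) M
  forwardSpansUsed-suc t<k spans a a∈M forward u c≤u u≤s =
    nested _ t<k u (spans a a∈M forward u c≤u u≤s)

  step-preserves-invariant : ∀ {x e y} → Invariant x → Step x e y → Invariant y
  step-preserves-invariant spans (arriveForward {M} i _) = spans′
    where
      spans′ : ForwardSpansUsed (suc (toℕ i)) ((i , σ i) ∷ M)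
      spans′ _ (here refl)  _ = permutationSpan-used i
      spans′ a (there a∈M) forward = forwardSpansUsed-suc (Fin.toℕ<n i) spans a a∈M forward
  step-preserves-invariant spans (arriveBackward i backward) =
    Fin.toℕ<n i , spans , ≰⇒> backward , proj₂ (σ-new i)
  step-preserves-invariant (t<k , spans , backward , s-unused)
                           (cancel M₁ M₂ c s c′ s′ forward overlapping _) =
    t<k , spans′ , ≰⇒> c′≰s , s-unused
    where
      c′≤c×s≤s′ = overlap⇒ends≤ forward backward overlapping
      c′s′∈M = ∈-++⁺ʳ M₁ (here refl)
      c′≰s : ¬ lc c′ ≤ ls s
      c′≰s c′≤s = s-unused (spans _ c′s′∈M forward s c′≤s (proj₂ c′≤c×s≤s′))
      spans′ : ForwardSpansUsed _ (M₁ ++ (c , s′) ∷ M₂)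
      spans′ a a∈M′ forward′ with ∈-++⁻ M₁ a∈M′
      ... | inj₁ a∈M₁         = spans a (∈-++⁺ˡ a∈M₁) forward′
      ... | inj₂ (here refl)  = λ u c≤u → spans _ c′s′∈M forward u (≤-trans (proj₁ c′≤c×s≤s′) c≤u)
      ... | inj₂ (there a∈M₂) = spans a (∈-++⁺ʳ M₁ (there a∈M₂)) forward′
  step-preserves-invariant (t<k , spans , backward , _) (finish _ _) = spans′
    where
      spans′ : ForwardSpansUsed _ (_ ∷ _)
      spans′ _ (here refl)  forward = ⊥-elim (<-irrefl refl (<-≤-trans backward forward))
      spans′ a (there a∈M) forward = forwardSpansUsed-suc t<k spans a a∈M forward

  reachable⇒invariant : ∀ {x} → Reachable x → Invariant x
  reachable⇒invariant start             = λ _ ()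
  reachable⇒invariant (next reach step) = step-preserves-invariant (reachable⇒invariant reach) step

mainTheorem10 : (k : ℕ) (lc ls : Fin k → ℚ) →
    Injective _≡_ _≡_ lc → Injective _≡_ _≡_ ls → (∀ i j → lc i ≢ ls j) →
    (Mstar : ℕ → Fin k → Fin k) →
    (∀ t → t ℕ.≤ k → IsMinCostMatching lc ls t (Mstar t)) →
    (∀ t → t ℕ.< k → ∀ s → UsedBy t (Mstar t) s → UsedBy (suc t) (Mstar (suc t)) s) →
    (σ : Fin k → Fin k) →
    (∀ i → UsedBy (suc (toℕ i)) (Mstar (suc (toℕ i))) (σ i)
           × ¬ UsedBy (toℕ i) (Mstar (toℕ i)) (σ i)) →
    ∀ {x y s c₁ c₂} →
    RecursiveCancel.Reachable lc ls σ x →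
    RecursiveCancel.Step lc ls σ x (just (s , c₁ , c₂)) y →
    lc c₁ ≤ lc c₂
mainTheorem10 k lc ls _ ls-injective lc≢ls Mstar optimal nested σ σ-new
              reach (RecursiveCancel.cancel _ _ _ _ _ _ forward overlapping _) =
  proj₁ (overlap⇒ends≤ forward (currentArc-backward (reachable⇒invariant reach)) overlapping)
  where open NestedOptimum lc ls ls-injective lc≢ls Mstar optimal nested σ σ-new
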